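{- Let $A = A_1 + \cdots + A_m$ be an FDDS that is a sum of cycles $A_1,\ldots,A_m$, each of length greater than $1$, and let $k \ge 1$ be an integer. Then there exist two different FDDS $X, Y$ such that $A_j X^k = A_j Y^k$ for all $1 \le j \le m$, and consequently $A X^k = A Y^k$.
   Context: An FDDS is a pair $(S,f)$ with $S$ finite and $f:S\to S$, up to isomorphism; sum is disjoint union and product is the direct product $(S,f)\times(T,g)=(S\times T,(s,t)\mapsto(f(s),g(t)))$. A cycle of length $q$ is the FDDS consisting of a single cycle of $q$ states. -}

module Defs where

open import Data.Nat using (ℕ; zero; suc; _+_; _*_; _%_)
open import Data.Nat.DivMod using (m%n<n)
open import Data.Fin using (Fin; toℕ; fromℕ<; splitAt; _↑ˡ_; _↑ʳ_; combine; remQuot)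
open import Data.Sum using (inj₁; inj₂)
open import Data.Product using (Σ; _,_; _×_; proj₁; proj₂)
open import Data.List using (List; []; _∷_)
open import Function.Bundles using (Inverse)
open import Relation.Binary.PropositionalEquality using (_≡_; setoid)
open import Level using (0ℓ)

record FDDS : Set where
  constructor fdds
  field
    size : ℕ
    map  : Fin size → Fin size
open FDDS public

-- Isomorphism of FDDS: a bijection h conjugating the two maps.
-- Equality of FDDS in the paper is equality up to this isomorphism.
_≅_ : FDDS → FDDS → Set
A ≅ B = Σ (Inverse (setoid (Fin (size A))) (setoid (Fin (size B)))) λ h →
          ∀ x → Inverse.to h (map A x) ≡ map B (Inverse.to h x)

infix 4 _≅_

_⊕_ : FDDS → FDDS → FDDS
fdds m f ⊕ fdds n g = fdds (m + n) h
  where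
  h : Fin (m + n) → Fin (m + n)
  h i with splitAt m i
  ... | inj₁ a = f a ↑ˡ n
  ... | inj₂ b = m ↑ʳ g b

_⊗_ : FDDS → FDDS → FDDS
fdds m f ⊗ fdds n g = fdds (m * n) h
  where
  h : Fin (m * n) → Fin (m * n)
  h i with remQuot n i
  ... | (a , b) = combine (f a) (g b)

infixl 6 _⊕_
infixl 7 _⊗_

𝟘 : FDDS
𝟘 = fdds 0 (λ ())

𝟙 : FDDS
𝟙 = fdds 1 (λ x → x)

_^_ : FDDS → ℕ → FDDS
X ^ zero  = 𝟙
X ^ suc k = X ⊗ (X ^ k)

infixr 8 _^_

Cycle : (q : ℕ) → FDDS
Cycle zero    = 𝟘
Cycle (suc n) = fdds (suc n) (λ i → fromℕ< (m%n<n (suc (toℕ i)) (suc n)))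

sumCycles : List ℕ → FDDS
sumCycles []       = 𝟘
sumCycles (q ∷ qs) = Cycle q ⊕ sumCycles qs

-- Write q·1 for q fixed points and C_q for the q-cycle. The map (i , x) ↦ (i , x + i) shows
-- C_q × q·1 ≅ C_q × C_q, so in the Grothendieck ring C_q annihilates q·1 − C_q, and hence every
-- C_{q_j} annihilates ∏_i (q_i·1 − C_{q_i}) = X − Y, where X and Y collect the terms of the
-- expanded product with an even resp. odd number of cycle factors. So C_{q_j} X ≅ C_{q_j} Y, which
-- survives taking k-th powers and summing over j. X ≇ Y: X contains the fixed point of 1 × ⋯ × 1,
-- whereas every summand of Y has a factor C_q with q > 1, which has no fixed point.
module Submission where

open import Defs
open import Data.Nat using (ℕ; _≤_; _<_)
open import Data.List using (List; length; lookup)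
open import Data.List.Relation.Unary.All using (All)
open import Data.Fin using (Fin)
open import Data.Product using (Σ; _×_)
open import Relation.Nullary using (¬_)

open import Data.Nat using (zero; suc; _+_; _*_; _∸_; _%_; _/_; NonZero)
open import Data.Nat.Properties using (+-identityʳ; +-suc; <⇒≤; m+[n∸m]≡n; m∸n+n≡m; m≤n⇒m<n∨m≡n; 1+n≢n; <-irrefl)
open import Data.Nat.DivMod using (m%n<n; m≡m%n+[m/n]*n; %-distribˡ-+; m%n%n≡m%n; [m+n]%n≡m%n; m<n⇒m%n≡m; n%n≡0)
open import Data.Fin using (toℕ; splitAt; join; remQuot; combine)
open import Data.Fin.Properties using (toℕ-fromℕ<; toℕ-injective; toℕ<n; splitAt-↑ˡ; splitAt-↑ʳ; splitAt-join; join-splitAt; remQuot-combine; combine-remQuot)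
open import Data.Empty using (⊥-elim)
open import Data.List using ([]; _∷_)
open import Data.List.Relation.Unary.All using ([]; _∷_)
open import Data.Product using (_,_; proj₁; proj₂; uncurry)
import Data.Product as Prod
open import Data.Sum using (_⊎_; inj₁; inj₂)
import Data.Sum as Sum
open import Data.Sum.Properties using (inj₁-injective; inj₂-injective)
open import Function using (id; _∘_)
open import Function.Bundles using (Inverse; mk↔ₛ′)
import Function.Endo.Propositional as Endo
open import Relation.Binary.PropositionalEquality

_^ᶠ_ : {A : Set} → (A → A) → ℕ → A → A
_^ᶠ_ {A} = Endo._^_ A

infixr 8 _^ᶠ_

^ᶠ-+ : {A : Set} (f : A → A) (m n : ℕ) (x : A) → (f ^ᶠ (m + n)) x ≡ (f ^ᶠ m) ((f ^ᶠ n) x)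
^ᶠ-+ {A} f m n = cong-app (Endo.^-homo A f m n)

module _ {A : Set} (f : A → A) (q : ℕ) .{{_ : NonZero q}} (periodic : ∀ x → (f ^ᶠ q) x ≡ x) where

  ^ᶠ-multiple-periodic : ∀ t x → (f ^ᶠ (t * q)) x ≡ x
  ^ᶠ-multiple-periodic zero    x = refl
  ^ᶠ-multiple-periodic (suc t) x = begin
    (f ^ᶠ (q + t * q)) x         ≡⟨ ^ᶠ-+ f q (t * q) x ⟩
    (f ^ᶠ q) ((f ^ᶠ (t * q)) x)  ≡⟨ cong (f ^ᶠ q) (^ᶠ-multiple-periodic t x) ⟩
    (f ^ᶠ q) x                   ≡⟨ periodic x ⟩
    x                            ∎
    where open ≡-Reasoning

  ^ᶠ-%-periodic : ∀ m x → (f ^ᶠ (m % q)) x ≡ (f ^ᶠ m) x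
  ^ᶠ-%-periodic m x = begin
    (f ^ᶠ (m % q)) x                          ≡⟨ cong (f ^ᶠ (m % q)) (^ᶠ-multiple-periodic (m / q) x) ⟨
    (f ^ᶠ (m % q)) ((f ^ᶠ (m / q * q)) x)     ≡⟨ ^ᶠ-+ f (m % q) (m / q * q) x ⟨
    (f ^ᶠ (m % q + m / q * q)) x              ≡⟨ cong (λ e → (f ^ᶠ e) x) (m≡m%n+[m/n]*n m q) ⟨
    (f ^ᶠ m) x                                ∎
    where open ≡-Reasoning

-- Dynamical systems on arbitrary carriers, up to conjugacy ≃: sums and products become ⊎ and ×
-- of carriers, so the algebra below needs no arithmetic on Fin.
record DynSys : Set₁ where
  constructor dyn
  field
    Carrier : Set
    step    : Carrier → Carrier
open DynSys

⟦_⟧ : FDDS → DynSys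
⟦ A ⟧ = dyn (Fin (size A)) (map A)

_×ˢ_ : DynSys → DynSys → DynSys
S ×ˢ T = dyn (Carrier S × Carrier T) (Prod.map (step S) (step T))

_⊎ˢ_ : DynSys → DynSys → DynSys
S ⊎ˢ T = dyn (Carrier S ⊎ Carrier T) (Sum.map (step S) (step T))

infixl 6 _⊎ˢ_
infixl 7 _×ˢ_

frozen : DynSys → DynSys
frozen S = dyn (Carrier S) id

record _≃_ (S T : DynSys) : Set where
  field
    to       : Carrier S → Carrier T
    from     : Carrier T → Carrier S
    to-from  : ∀ y → to (from y) ≡ y
    from-to  : ∀ x → from (to x) ≡ x
    commutes : ∀ x → to (step S x) ≡ step T (to x)
open _≃_

infix 4 _≃_

≃-refl : ∀ {S} → S ≃ S
≃-refl = record { to = id ; from = id ; to-from = λ _ → refl ; from-to = λ _ → refl ; commutes = λ _ → refl }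

≃-sym : ∀ {S T} → S ≃ T → T ≃ S
≃-sym {S} {T} e = record
  { to = from e ; from = to e ; to-from = from-to e ; from-to = to-from e ; commutes = commutes-from }
  where
  commutes-from : ∀ y → from e (step T y) ≡ step S (from e y)
  commutes-from y = begin
    from e (step T y)                   ≡⟨ cong (λ z → from e (step T z)) (to-from e y) ⟨
    from e (step T (to e (from e y)))   ≡⟨ cong (from e) (commutes e (from e y)) ⟨
    from e (to e (step S (from e y)))   ≡⟨ from-to e _ ⟩
    step S (from e y)                   ∎
    where open ≡-Reasoning

infixr 2 _⟨≃⟩_

_⟨≃⟩_ : ∀ {S T U} → S ≃ T → T ≃ U → S ≃ U
e ⟨≃⟩ d = record
  { to = λ x → to d (to e x) ; from = λ x → from e (from d x)
  ; to-from = λ y → trans (cong (to d) (to-from e _)) (to-from d y)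
  ; from-to = λ x → trans (cong (from e) (from-to d _)) (from-to e x)
  ; commutes = λ x → trans (cong (to d) (commutes e x)) (commutes d _) }

×-cong : ∀ {S S′ T T′} → S ≃ S′ → T ≃ T′ → S ×ˢ T ≃ S′ ×ˢ T′
×-cong e d = record
  { to = Prod.map (to e) (to d) ; from = Prod.map (from e) (from d)
  ; to-from = λ (x , y) → cong₂ _,_ (to-from e x) (to-from d y)
  ; from-to = λ (x , y) → cong₂ _,_ (from-to e x) (from-to d y)
  ; commutes = λ (x , y) → cong₂ _,_ (commutes e x) (commutes d y) }

⊎-cong : ∀ {S S′ T T′} → S ≃ S′ → T ≃ T′ → S ⊎ˢ T ≃ S′ ⊎ˢ T′
⊎-cong e d = record
  { to = Sum.map (to e) (to d) ; from = Sum.map (from e) (from d)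
  ; to-from = λ { (inj₁ x) → cong inj₁ (to-from e x) ; (inj₂ y) → cong inj₂ (to-from d y) }
  ; from-to = λ { (inj₁ x) → cong inj₁ (from-to e x) ; (inj₂ y) → cong inj₂ (from-to d y) }
  ; commutes = λ { (inj₁ x) → cong inj₁ (commutes e x) ; (inj₂ y) → cong inj₂ (commutes d y) } }

×-comm : ∀ S T → S ×ˢ T ≃ T ×ˢ S
×-comm S T = record
  { to = Prod.swap ; from = Prod.swap
  ; to-from = λ _ → refl ; from-to = λ _ → refl ; commutes = λ _ → refl }

×-assoc : ∀ S T U → (S ×ˢ T) ×ˢ U ≃ S ×ˢ (T ×ˢ U)
×-assoc S T U = record
  { to = Prod.assocʳ′ ; from = Prod.assocˡ′
  ; to-from = λ _ → refl ; from-to = λ _ → refl ; commutes = λ _ → refl }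

×-swapˡ : ∀ S T U → S ×ˢ (T ×ˢ U) ≃ T ×ˢ (S ×ˢ U)
×-swapˡ S T U = ≃-sym (×-assoc S T U) ⟨≃⟩ ×-cong (×-comm S T) ≃-refl ⟨≃⟩ ×-assoc T S U

⊎-comm : ∀ S T → S ⊎ˢ T ≃ T ⊎ˢ S
⊎-comm S T = record
  { to = Sum.swap ; from = Sum.swap
  ; to-from = λ { (inj₁ _) → refl ; (inj₂ _) → refl }
  ; from-to = λ { (inj₁ _) → refl ; (inj₂ _) → refl }
  ; commutes = λ { (inj₁ _) → refl ; (inj₂ _) → refl } }

×-distribˡ-⊎ : ∀ S T U → S ×ˢ (T ⊎ˢ U) ≃ S ×ˢ T ⊎ˢ S ×ˢ U
×-distribˡ-⊎ S T U = record { to = distrib ; from = factor ; to-from = to-from′ ; from-to = from-to′ ; commutes = commutes′ }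
  where
  distrib : Carrier S × (Carrier T ⊎ Carrier U) → Carrier S × Carrier T ⊎ Carrier S × Carrier U
  distrib (s , inj₁ t) = inj₁ (s , t)
  distrib (s , inj₂ u) = inj₂ (s , u)
  factor : Carrier S × Carrier T ⊎ Carrier S × Carrier U → Carrier S × (Carrier T ⊎ Carrier U)
  factor = Sum.[ Prod.map₂ inj₁ , Prod.map₂ inj₂ ]
  to-from′ : ∀ y → distrib (factor y) ≡ y
  to-from′ (inj₁ _) = refl
  to-from′ (inj₂ _) = refl
  from-to′ : ∀ x → factor (distrib x) ≡ x
  from-to′ (_ , inj₁ _) = refl
  from-to′ (_ , inj₂ _) = refl
  commutes′ : ∀ x → distrib (step (S ×ˢ (T ⊎ˢ U)) x) ≡ step (S ×ˢ T ⊎ˢ S ×ˢ U) (distrib x)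
  commutes′ (_ , inj₁ _) = refl
  commutes′ (_ , inj₂ _) = refl

×-distribʳ-⊎ : ∀ S T U → (T ⊎ˢ U) ×ˢ S ≃ T ×ˢ S ⊎ˢ U ×ˢ S
×-distribʳ-⊎ S T U = ×-comm (T ⊎ˢ U) S ⟨≃⟩ ×-distribˡ-⊎ S T U ⟨≃⟩ ⊎-cong (×-comm S T) (×-comm S U)

⊕-hom : ∀ A B → ⟦ A ⊕ B ⟧ ≃ ⟦ A ⟧ ⊎ˢ ⟦ B ⟧
⊕-hom (fdds m f) (fdds n g) = record
  { to = splitAt m ; from = join m n ; to-from = splitAt-join m n ; from-to = join-splitAt m n ; commutes = commutes′ }
  where
  commutes′ : ∀ x → splitAt m (map (fdds m f ⊕ fdds n g) x) ≡ Sum.map f g (splitAt m x)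
  commutes′ x with splitAt m x
  ... | inj₁ a = splitAt-↑ˡ m (f a) n
  ... | inj₂ b = splitAt-↑ʳ m n (g b)

⊗-hom : ∀ A B → ⟦ A ⊗ B ⟧ ≃ ⟦ A ⟧ ×ˢ ⟦ B ⟧
⊗-hom (fdds m f) (fdds n g) = record
  { to = remQuot n ; from = uncurry combine ; to-from = uncurry remQuot-combine
  ; from-to = combine-remQuot {m} n
  ; commutes = λ x → remQuot-combine (f (proj₁ (remQuot {m} n x))) (g (proj₂ (remQuot {m} n x))) }

≃⇒≅ : ∀ {A B} → ⟦ A ⟧ ≃ ⟦ B ⟧ → A ≅ B
≃⇒≅ e = mk↔ₛ′ (to e) (from e) (to-from e) (from-to e) , commutes e

_∼[_]_ : DynSys → DynSys → DynSys → Set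
A ∼[ D ] B = D ×ˢ A ≃ D ×ˢ B

infix 4 _∼[_]_

≃⇒∼ : ∀ {D A B} → A ≃ B → A ∼[ D ] B
≃⇒∼ = ×-cong ≃-refl

×-cong-∼ : ∀ {D A A′ B B′} → A ∼[ D ] B → A′ ∼[ D ] B′ → A ×ˢ A′ ∼[ D ] B ×ˢ B′
×-cong-∼ {D} {A} {A′} {B} {B′} A∼B A′∼B′ =
  ×-swapˡ D A A′ ⟨≃⟩ ×-cong ≃-refl A′∼B′ ⟨≃⟩ ≃-sym (×-assoc A D B′)
  ⟨≃⟩ ×-cong (×-comm A D ⟨≃⟩ A∼B) ≃-refl ⟨≃⟩ ×-assoc D B B′

⊎-cong-∼ : ∀ {D A A′ B B′} → A ∼[ D ] B → A′ ∼[ D ] B′ → A ⊎ˢ A′ ∼[ D ] B ⊎ˢ B′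
⊎-cong-∼ {D} {A} {A′} {B} {B′} A∼B A′∼B′ =
  ×-distribˡ-⊎ D A A′ ⟨≃⟩ ⊎-cong A∼B A′∼B′ ⟨≃⟩ ≃-sym (×-distribˡ-⊎ D B B′)

∼-⊎-factor : ∀ {D E A B} → A ∼[ D ] B → A ∼[ E ] B → A ∼[ D ⊎ˢ E ] B
∼-⊎-factor {D} {E} {A} {B} A∼[D]B A∼[E]B =
  ×-distribʳ-⊎ A D E ⟨≃⟩ ⊎-cong A∼[D]B A∼[E]B ⟨≃⟩ ≃-sym (×-distribʳ-⊎ B D E)

∼-empty-factor : ∀ {D A B} → ¬ Carrier D → A ∼[ D ] B
∼-empty-factor ¬d = record
  { to = λ (d , _) → ⊥-elim (¬d d) ; from = λ (d , _) → ⊥-elim (¬d d)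
  ; to-from = λ (d , _) → ⊥-elim (¬d d) ; from-to = λ (d , _) → ⊥-elim (¬d d)
  ; commutes = λ (d , _) → ⊥-elim (¬d d) }

∼-resp-factor : ∀ {D D′ A B} → D′ ≃ D → A ∼[ D ] B → A ∼[ D′ ] B
∼-resp-factor D′≃D A∼B = ×-cong D′≃D ≃-refl ⟨≃⟩ A∼B ⟨≃⟩ ×-cong (≃-sym D′≃D) ≃-refl

module _ (n : ℕ) where

  private
    q = suc n

  toℕ-cycle : ∀ i → toℕ (map (Cycle q) i) ≡ suc (toℕ i) % q
  toℕ-cycle i = toℕ-fromℕ< (m%n<n (suc (toℕ i)) q)

  toℕ-cycle-^ᶠ : ∀ t i → toℕ ((map (Cycle q) ^ᶠ t) i) ≡ (toℕ i + t) % q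
  toℕ-cycle-^ᶠ zero    i = sym (trans (cong (_% q) (+-identityʳ (toℕ i))) (m<n⇒m%n≡m (toℕ<n i)))
  toℕ-cycle-^ᶠ (suc t) i = begin
    toℕ (map (Cycle q) ((map (Cycle q) ^ᶠ t) i))  ≡⟨ toℕ-cycle _ ⟩
    suc (toℕ ((map (Cycle q) ^ᶠ t) i)) % q        ≡⟨ cong (λ e → suc e % q) (toℕ-cycle-^ᶠ t i) ⟩
    (1 + (toℕ i + t) % q) % q                     ≡⟨ %-distribˡ-+ 1 ((toℕ i + t) % q) q ⟩
    (1 % q + (toℕ i + t) % q % q) % q             ≡⟨ cong (λ e → (1 % q + e) % q) (m%n%n≡m%n (toℕ i + t) q) ⟩
    (1 % q + (toℕ i + t) % q) % q                 ≡⟨ %-distribˡ-+ 1 (toℕ i + t) q ⟨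
    suc (toℕ i + t) % q                           ≡⟨ cong (_% q) (+-suc (toℕ i) t) ⟨
    (toℕ i + suc t) % q                           ∎
    where open ≡-Reasoning

  cycle-periodic : ∀ i → (map (Cycle q) ^ᶠ q) i ≡ i
  cycle-periodic i = toℕ-injective (begin
    toℕ ((map (Cycle q) ^ᶠ q) i)  ≡⟨ toℕ-cycle-^ᶠ q i ⟩
    (toℕ i + q) % q               ≡⟨ [m+n]%n≡m%n (toℕ i) q ⟩
    toℕ i % q                     ≡⟨ m<n⇒m%n≡m (toℕ<n i) ⟩
    toℕ i                         ∎)
    where open ≡-Reasoning

  cycle-no-fixedPoint : 1 < q → ∀ i → map (Cycle q) i ≢ i
  cycle-no-fixedPoint 1<q i fixed with m≤n⇒m<n∨m≡n (toℕ<n i)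
  ... | inj₁ 1+i<q = 1+n≢n (trans (sym (m<n⇒m%n≡m 1+i<q)) wraps)
    where
    wraps : suc (toℕ i) % q ≡ toℕ i
    wraps = trans (sym (toℕ-cycle i)) (cong toℕ fixed)
  ... | inj₂ 1+i≡q = <-irrefl 1≡q 1<q
    where
    i≡0 : toℕ i ≡ 0
    i≡0 = begin
      toℕ i                  ≡⟨ cong toℕ fixed ⟨
      toℕ (map (Cycle q) i)  ≡⟨ toℕ-cycle i ⟩
      suc (toℕ i) % q        ≡⟨ cong (_% q) 1+i≡q ⟩
      q % q                  ≡⟨ n%n≡0 q ⟩
      0                      ∎
      where open ≡-Reasoning
    1≡q : 1 ≡ q
    1≡q = trans (cong suc (sym i≡0)) 1+i≡q

module _ (n : ℕ) (T : DynSys) (periodic : ∀ x → (step T ^ᶠ suc n) x ≡ x) where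

  private
    q = suc n
    g = step T

  frozen-∼-periodic : frozen T ∼[ ⟦ Cycle q ⟧ ] T
  frozen-∼-periodic = record
    { to = λ (i , x) → i , (g ^ᶠ toℕ i) x
    ; from = λ (i , y) → i , (g ^ᶠ (q ∸ toℕ i)) y
    ; to-from = λ (i , y) → cong (i ,_) (cancel (toℕ i) (q ∸ toℕ i) (m+[n∸m]≡n (<⇒≤ (toℕ<n i))) y)
    ; from-to = λ (i , x) → cong (i ,_) (cancel (q ∸ toℕ i) (toℕ i) (m∸n+n≡m (<⇒≤ (toℕ<n i))) x)
    ; commutes = λ (i , x) → cong (map (Cycle q) i ,_) (begin
        (g ^ᶠ toℕ (map (Cycle q) i)) x  ≡⟨ cong (λ e → (g ^ᶠ e) x) (toℕ-cycle n i) ⟩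
        (g ^ᶠ (suc (toℕ i) % q)) x      ≡⟨ ^ᶠ-%-periodic g q periodic (suc (toℕ i)) x ⟩
        g ((g ^ᶠ toℕ i) x)              ∎) }
    where
    open ≡-Reasoning
    cancel : ∀ a b → a + b ≡ q → ∀ x → (g ^ᶠ a) ((g ^ᶠ b) x) ≡ x
    cancel a b a+b≡q x = begin
      (g ^ᶠ a) ((g ^ᶠ b) x)  ≡⟨ ^ᶠ-+ g a b x ⟨
      (g ^ᶠ (a + b)) x       ≡⟨ cong (λ e → (g ^ᶠ e) x) a+b≡q ⟩
      (g ^ᶠ q) x             ≡⟨ periodic x ⟩
      x                      ∎

FixedPoints : ℕ → FDDS
FixedPoints q = fdds q id

fixedPoints-∼-cycle : ∀ q → ⟦ FixedPoints q ⟧ ∼[ ⟦ Cycle q ⟧ ] ⟦ Cycle q ⟧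
fixedPoints-∼-cycle zero    = ∼-empty-factor (λ ())
fixedPoints-∼-cycle (suc n) = frozen-∼-periodic n ⟦ Cycle (suc n) ⟧ (cycle-periodic n)

-- A formal difference P − N of FDDS, multiplied as in the Grothendieck ring.
Difference : Set
Difference = FDDS × FDDS

_⊡_ : Difference → Difference → Difference
(P , N) ⊡ (P′ , N′) = P ⊗ P′ ⊕ N ⊗ N′ , P ⊗ N′ ⊕ N ⊗ P′

Vanishes : DynSys → Difference → Set
Vanishes D (P , N) = ⟦ P ⟧ ∼[ D ] ⟦ N ⟧

expand : ∀ A B C E → ⟦ A ⊗ B ⊕ C ⊗ E ⟧ ≃ ⟦ A ⟧ ×ˢ ⟦ B ⟧ ⊎ˢ ⟦ C ⟧ ×ˢ ⟦ E ⟧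
expand A B C E = ⊕-hom (A ⊗ B) (C ⊗ E) ⟨≃⟩ ⊎-cong (⊗-hom A B) (⊗-hom C E)

⊡-vanishesˡ : ∀ {D} d e → Vanishes D d → Vanishes D (d ⊡ e)
⊡-vanishesˡ (P , N) (P′ , N′) P∼N =
  ≃⇒∼ (expand P P′ N N′)
  ⟨≃⟩ ⊎-cong-∼ (×-cong-∼ P∼N ≃-refl) (×-cong-∼ (≃-sym P∼N) ≃-refl)
  ⟨≃⟩ ≃⇒∼ (⊎-comm _ _ ⟨≃⟩ ≃-sym (expand P N′ N P′))

⊡-vanishesʳ : ∀ {D} d e → Vanishes D e → Vanishes D (d ⊡ e)
⊡-vanishesʳ (P , N) (P′ , N′) P′∼N′ =
  ≃⇒∼ (expand P P′ N N′)
  ⟨≃⟩ ⊎-cong-∼ (×-cong-∼ ≃-refl P′∼N′) (×-cong-∼ ≃-refl (≃-sym P′∼N′))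
  ⟨≃⟩ ≃⇒∼ (≃-sym (expand P N′ N P′))

cycleDifference : ℕ → Difference
cycleDifference q = FixedPoints q , Cycle q

differenceProduct : List ℕ → Difference
differenceProduct []       = 𝟙 , 𝟘
differenceProduct (q ∷ qs) = cycleDifference q ⊡ differenceProduct qs

differenceProduct-vanishes : ∀ qs (j : Fin (length qs)) → Vanishes ⟦ Cycle (lookup qs j) ⟧ (differenceProduct qs)
differenceProduct-vanishes (q ∷ qs) Fin.zero    = ⊡-vanishesˡ (cycleDifference q) (differenceProduct qs) (fixedPoints-∼-cycle q)
differenceProduct-vanishes (q ∷ qs) (Fin.suc j) = ⊡-vanishesʳ (cycleDifference q) (differenceProduct qs) (differenceProduct-vanishes qs j)

HasFixedPoint : DynSys → Set
HasFixedPoint S = Σ (Carrier S) λ x → step S x ≡ x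

fixedPoint-image : ∀ {S T} (h : Carrier S → Carrier T) → (∀ x → h (step S x) ≡ step T (h x)) →
  HasFixedPoint S → HasFixedPoint T
fixedPoint-image h commutes (x , fixed) = h x , trans (sym (commutes x)) (cong h fixed)

≃-fixedPoint : ∀ {S T} → S ≃ T → HasFixedPoint S → HasFixedPoint T
≃-fixedPoint e = fixedPoint-image (to e) (commutes e)

×-fixedPoint : ∀ {S T} → HasFixedPoint S → HasFixedPoint T → HasFixedPoint (S ×ˢ T)
×-fixedPoint (x , x-fixed) (y , y-fixed) = (x , y) , cong₂ _,_ x-fixed y-fixed

×-fixedPointˡ : ∀ {S T} → HasFixedPoint (S ×ˢ T) → HasFixedPoint S
×-fixedPointˡ ((x , _) , fixed) = x , cong proj₁ fixed

×-fixedPointʳ : ∀ {S T} → HasFixedPoint (S ×ˢ T) → HasFixedPoint T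
×-fixedPointʳ ((_ , y) , fixed) = y , cong proj₂ fixed

⊎-fixedPointˡ : ∀ {S T} → HasFixedPoint S → HasFixedPoint (S ⊎ˢ T)
⊎-fixedPointˡ (x , fixed) = inj₁ x , cong inj₁ fixed

⊎-fixedPoint : ∀ {S T} → HasFixedPoint (S ⊎ˢ T) → HasFixedPoint S ⊎ HasFixedPoint T
⊎-fixedPoint (inj₁ x , fixed) = inj₁ (x , inj₁-injective fixed)
⊎-fixedPoint (inj₂ y , fixed) = inj₂ (y , inj₂-injective fixed)

FixedPointSeparated : Difference → Set
FixedPointSeparated (P , N) = HasFixedPoint ⟦ P ⟧ × ¬ HasFixedPoint ⟦ N ⟧

⊡-fixedPointSeparated : ∀ d e → FixedPointSeparated d → FixedPointSeparated e → FixedPointSeparated (d ⊡ e)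
⊡-fixedPointSeparated (P , N) (P′ , N′) (fixP , ¬fixN) (fixP′ , ¬fixN′) =
  ≃-fixedPoint (≃-sym (expand P P′ N N′)) (⊎-fixedPointˡ (×-fixedPoint fixP fixP′)) ,
  λ fix → Sum.[ ¬fixN′ ∘ ×-fixedPointʳ , ¬fixN ∘ ×-fixedPointˡ ]
            (⊎-fixedPoint (≃-fixedPoint (expand P N′ N P′) fix))

cycleDifference-fixedPointSeparated : ∀ {q} → 1 < q → FixedPointSeparated (cycleDifference q)
cycleDifference-fixedPointSeparated {suc n} 1<q =
  (Fin.zero , refl) , λ (i , fixed) → cycle-no-fixedPoint n 1<q i fixed

differenceProduct-fixedPointSeparated : ∀ {qs} → All (1 <_) qs → FixedPointSeparated (differenceProduct qs)
differenceProduct-fixedPointSeparated []         = (Fin.zero , refl) , λ ()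
differenceProduct-fixedPointSeparated (1<q ∷ ps) =
  ⊡-fixedPointSeparated _ _ (cycleDifference-fixedPointSeparated 1<q) (differenceProduct-fixedPointSeparated ps)

^-cong-∼ : ∀ {D} X Y → ⟦ X ⟧ ∼[ D ] ⟦ Y ⟧ → ∀ k → ⟦ X ^ k ⟧ ∼[ D ] ⟦ Y ^ k ⟧
^-cong-∼ X Y X∼Y zero    = ≃-refl
^-cong-∼ X Y X∼Y (suc k) =
  ≃⇒∼ (⊗-hom X (X ^ k)) ⟨≃⟩ ×-cong-∼ X∼Y (^-cong-∼ X Y X∼Y k) ⟨≃⟩ ≃⇒∼ (≃-sym (⊗-hom Y (Y ^ k)))

sumCycles-∼ : ∀ qs {A B} → (∀ (j : Fin (length qs)) → A ∼[ ⟦ Cycle (lookup qs j) ⟧ ] B) → A ∼[ ⟦ sumCycles qs ⟧ ] B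
sumCycles-∼ []       _ = ∼-empty-factor (λ ())
sumCycles-∼ (q ∷ qs) A∼B = ∼-resp-factor (⊕-hom (Cycle q) (sumCycles qs))
  (∼-⊎-factor (A∼B Fin.zero) (sumCycles-∼ qs (λ j → A∼B (Fin.suc j))))

∼⇒≅ : ∀ A {B C} → ⟦ B ⟧ ∼[ ⟦ A ⟧ ] ⟦ C ⟧ → A ⊗ B ≅ A ⊗ C
∼⇒≅ A {B} {C} B∼C = ≃⇒≅ (⊗-hom A B ⟨≃⟩ B∼C ⟨≃⟩ ≃-sym (⊗-hom A C))

lemma8 : (qs : List ℕ) → All (1 <_) qs → (k : ℕ) → 1 ≤ k →
    Σ FDDS λ X → Σ FDDS λ Y →
      ¬ (X ≅ Y)
      × (∀ (j : Fin (length qs)) → Cycle (lookup qs j) ⊗ X ^ k ≅ Cycle (lookup qs j) ⊗ Y ^ k)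
      × (sumCycles qs ⊗ X ^ k ≅ sumCycles qs ⊗ Y ^ k)
lemma8 qs all>1 k _ = X , Y , X≇Y , each , total
  where
  X = proj₁ (differenceProduct qs)
  Y = proj₂ (differenceProduct qs)
  vanishes = differenceProduct-vanishes qs
  each = λ j → ∼⇒≅ (Cycle (lookup qs j)) (^-cong-∼ X Y (vanishes j) k)
  total = ∼⇒≅ (sumCycles qs) (^-cong-∼ X Y (sumCycles-∼ qs vanishes) k)
  X≇Y : ¬ (X ≅ Y)
  X≇Y (h , commutes) with differenceProduct-fixedPointSeparated all>1
  ... | fixX , ¬fixY = ¬fixY (fixedPoint-image (Inverse.to h) commutes fixX)
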